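{- Let $(n_j,k_j)_{j\geqslant 1}$ be a sequence of pairs of integers with $n_j>2k_j$ and $k_j\geqslant 3$ for all $j$, $n_j\to\infty$, and such that $r_j/k_j$ does not tend to $0$, where $r_j$ is the integer in $\{0,\ldots,k_j-1\}$ with $r_j\equiv n_j \pmod{k_j}$. Then ${\rm NLB}(n_j,k_j)/{\rm MMS}(n_j,k_j)$ does not tend to $1$ as $j\to\infty$.
   Context: For integers $n\geqslant k\geqslant 1$, $c$ and $r$ denote the unique integers with $n=ck+r$ and $r\in\{0,\ldots,k-1\}$. Define ${\rm MMS}(n,k)=\binom{n}{c}\big/\big(k-r+\frac{r(c+1)}{n-c}\big)$ and ${\rm NLB}(n,k)=\frac{1}{k}\binom{n-r}{c}$. -}

module Defs where

import Data.Nat as N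
open N using (ℕ; zero; suc; _∸_; NonZero)
open import Data.Nat.DivMod using (_/_; _%_)
open import Data.Nat.Combinatorics using (_C_)
open import Data.Rational as ℚ using (ℚ; _+_; _-_; _÷_; ∣_∣; _<_; _≤_; 0ℚ)
open import Data.Rational.Properties using (_≟_)
open import Data.Product using (∃)
import Data.Integer as ℤ
open import Relation.Nullary using (yes; no)

⟦_⟧ : ℕ → ℚ
⟦ m ⟧ = (ℤ.+ m) ℚ./ 1

-- total division on ℚ (x / 0 := 0); only used where the divisor is positive
_÷'_ : ℚ → ℚ → ℚ
p ÷' q with q ≟ 0ℚ
... | yes _ = 0ℚ
... | no q≢0 = _÷_ p q {{ℚ.≢-nonZero q≢0}}

cc : (n k : ℕ) → .{{NonZero k}} → ℕ
cc n k = n / k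

rr : (n k : ℕ) → .{{NonZero k}} → ℕ
rr n k = n % k

MMS : (n k : ℕ) → .{{NonZero k}} → ℚ
MMS n k = ⟦ n C c ⟧ ÷' ((⟦ k ⟧ - ⟦ r ⟧) + (⟦ r N.* suc c ⟧ ÷' ⟦ n ∸ c ⟧))
  where
    c = cc n k
    r = rr n k

NLB : (n k : ℕ) → .{{NonZero k}} → ℚ
NLB n k = ⟦ (n ∸ rr n k) C cc n k ⟧ ÷' ⟦ k ⟧

_⟶_ : (ℕ → ℚ) → ℚ → Set
a ⟶ L = ∀ (ε : ℚ) → 0ℚ < ε → ∃ λ N → ∀ j → N N.≤ j → ∣ a j - L ∣ < ε

_⟶∞ : (ℕ → ℕ) → Set
a ⟶∞ = ∀ (M : ℕ) → ∃ λ N → ∀ j → N N.≤ j → M N.≤ a j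

≥3-nonZero : ∀ {k} → 3 N.≤ k → NonZero k
≥3-nonZero (N.s≤s _) = _

-- Writing c = n/k and r = n mod k,
--   NLB/MMS = (C(n-r,c) / C(n,c)) · (k - r + r(c+1)/(n-c)) / k.
-- The binomial quotient is at most 1, and n > 2k gives c ≥ 2 and n - c ≥ 2c, so that
-- r(c+1)/(n-c) ≤ 3r/4.  Hence r/k ≤ 4(1 - NLB/MMS) for every single pair (n,k), and
-- NLB/MMS → 1 would force r/k → 0.
module Submission where

open import Defs

module _ where
  open import Data.Nat
  open import Data.Nat.Properties
  open import Data.Nat.DivMod
  open import Data.Nat.Combinatorics
  open import Relation.Binary.PropositionalEquality
  open import Algebra.Properties.CommutativeSemigroup *-commutativeSemigroup using (x∙yz≈y∙xz)

  nCk≤[1+n]Ck : ∀ n k → n C k ≤ suc n C k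
  nCk≤[1+n]Ck n zero    = ≤-refl
  nCk≤[1+n]Ck n (suc k) =
    subst (n C suc k ≤_) (nCk+nC[k+1]≡[n+1]C[k+1] n k) (m≤n+m (n C suc k) (n C k))

  C-monoˡ-≤ : ∀ {m n} k → m ≤ n → m C k ≤ n C k
  C-monoˡ-≤ {m} k m≤n = go (≤⇒≤′ m≤n)
    where
    go : ∀ {n} → m ≤′ n → m C k ≤ n C k
    go ≤′-refl        = ≤-refl
    go (≤′-step m≤′n) = ≤-trans (go m≤′n) (nCk≤[1+n]Ck _ k)

  k≤n⇒0<nCk : ∀ {n k} → k ≤ n → 0 < n C k
  k≤n⇒0<nCk {n} {k} k≤n = subst (_≤ n C k) (nCn≡1 k) (C-monoˡ-≤ k k≤n)

  module _ (n k : ℕ) .{{_ : NonZero k}} (3≤k : 3 ≤ k) (2k<n : 2 * k < n) where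
    private
      c : ℕ
      c = n / k

    2≤n/k : 2 ≤ c
    2≤n/k = subst (_≤ c) (m*n/n≡m 2 k) (/-monoˡ-≤ k (<⇒≤ 2k<n))

    n/k<n : c < n
    n/k<n = m/n<m n k {{>-nonZero (m<n⇒0<n 2k<n)}} (≤-trans (s≤s (s≤s z≤n)) 3≤k)

    4*[1+n/k]≤3*[n∸n/k] : 4 * suc c ≤ 3 * (n ∸ c)
    4*[1+n/k]≤3*[n∸n/k] = begin
      4 * suc c       ≡⟨ *-suc 4 c ⟩
      4 + 4 * c       ≤⟨ +-monoˡ-≤ (4 * c) (*-monoʳ-≤ 2 2≤n/k) ⟩
      2 * c + 4 * c   ≡⟨ *-distribʳ-+ c 2 4 ⟨
      (3 * 2) * c     ≡⟨ *-assoc 3 2 c ⟩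
      3 * (2 * c)     ≤⟨ *-monoʳ-≤ 3 2c≤n∸c ⟩
      3 * (n ∸ c)     ∎
      where
      open ≤-Reasoning
      3c≤n : 3 * c ≤ n
      3c≤n = begin
        3 * c  ≡⟨ *-comm 3 c ⟩
        c * 3  ≤⟨ *-monoʳ-≤ c 3≤k ⟩
        c * k  ≤⟨ m/n*n≤m n k ⟩
        n      ∎
      2c≤n∸c : 2 * c ≤ n ∸ c
      2c≤n∸c = m+n≤o⇒m≤o∸n (2 * c) (subst (_≤ n) (+-comm c (2 * c)) 3c≤n)

    4*[r*[1+n/k]]≤3*r*[n∸n/k] : ∀ r → 4 * (r * suc c) ≤ 3 * r * (n ∸ c)
    4*[r*[1+n/k]]≤3*r*[n∸n/k] r = begin
      4 * (r * suc c)    ≡⟨ x∙yz≈y∙xz 4 r (suc c) ⟩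
      r * (4 * suc c)    ≤⟨ *-monoʳ-≤ r 4*[1+n/k]≤3*[n∸n/k] ⟩
      r * (3 * (n ∸ c))  ≡⟨ x∙yz≈y∙xz r 3 (n ∸ c) ⟩
      3 * (r * (n ∸ c))  ≡⟨ *-assoc 3 r (n ∸ c) ⟨
      3 * r * (n ∸ c)    ∎
      where open ≤-Reasoning

module _ where
  open import Data.Rational
  open import Data.Rational.Properties
  open import Data.Rational.Solver
  open +-*-Solver using (solve; _:=_; _:+_; _:*_; _:-_; :-_; con)
  import Data.Integer as ℤ
  import Data.Integer.Properties as ℤ
  import Data.Nat as ℕ
  import Data.Nat.Properties as ℕ
  import Data.Nat.Coprimality as ℕ
  open import Data.Empty using (⊥-elim)
  open import Data.Product using (_,_)
  open import Relation.Nullary using (yes; no)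
  open import Relation.Binary.PropositionalEquality
  open import Data.Nat.DivMod using (m%n<n)
  open import Data.Nat.Combinatorics using (_C_)

  ÷'≡÷ : ∀ p q (q>0 : 0ℚ < q) → p ÷' q ≡ (p ÷ q) {{>-nonZero q>0}}
  ÷'≡÷ p q q>0 with q ≟ 0ℚ
  ... | yes refl = ⊥-elim (<-irrefl refl q>0)
  ... | no _     = refl

  ÷'-*-cancel : ∀ p {q} → 0ℚ < q → (p ÷' q) * q ≡ p
  ÷'-*-cancel p {q} q>0 = begin
    (p ÷' q) * q     ≡⟨ cong (_* q) (÷'≡÷ p q q>0) ⟩
    (p * 1/ q) * q   ≡⟨ *-assoc p (1/ q) q ⟩
    p * (1/ q * q)   ≡⟨ cong (p *_) (*-inverseˡ q) ⟩
    p * 1ℚ           ≡⟨ *-identityʳ p ⟩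
    p                ∎
    where
    open ≡-Reasoning
    instance _ = >-nonZero q>0

  ÷'-nonNeg : ∀ {p q} → 0ℚ ≤ p → 0ℚ < q → 0ℚ ≤ p ÷' q
  ÷'-nonNeg {p} {q} p≥0 q>0 = *-cancelʳ-≤-pos q {{positive q>0}}
    (subst₂ _≤_ (sym (*-zeroˡ q)) (sym (÷'-*-cancel p q>0)) p≥0)

  ÷'-pos : ∀ {p q} → 0ℚ < p → 0ℚ < q → 0ℚ < p ÷' q
  ÷'-pos {p} {q} p>0 q>0 = *-cancelʳ-<-nonNeg q {{nonNegative (<⇒≤ q>0)}}
    (subst₂ _<_ (sym (*-zeroˡ q)) (sym (÷'-*-cancel p q>0)) p>0)

  *-÷'-≤ : ∀ c {y d z} → 0ℚ < z → c * y ≤ d * z → c * (y ÷' z) ≤ d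
  *-÷'-≤ c {y} {d} {z} z>0 cy≤dz = *-cancelʳ-≤-pos z {{positive z>0}} (begin
    c * (y ÷' z) * z    ≡⟨ *-assoc c (y ÷' z) z ⟩
    c * ((y ÷' z) * z)  ≡⟨ cong (c *_) (÷'-*-cancel y z>0) ⟩
    c * y               ≤⟨ cy≤dz ⟩
    d * z               ∎)
    where open ≤-Reasoning

  ⟦⟧≡mkℚ : ∀ m → ⟦ m ⟧ ≡ mkℚ (ℤ.+ m) 0 (ℕ.sym (ℕ.1-coprimeTo m))
  ⟦⟧≡mkℚ m = ↥p/↧p≡p (mkℚ (ℤ.+ m) 0 (ℕ.sym (ℕ.1-coprimeTo m)))

  ⟦⟧-mono-≤ : ∀ {m n} → m ℕ.≤ n → ⟦ m ⟧ ≤ ⟦ n ⟧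
  ⟦⟧-mono-≤ {m} {n} m≤n rewrite ⟦⟧≡mkℚ m | ⟦⟧≡mkℚ n =
    *≤* (subst₂ ℤ._≤_ (sym (ℤ.*-identityʳ _)) (sym (ℤ.*-identityʳ _)) (ℤ.+≤+ m≤n))

  ⟦⟧-mono-< : ∀ {m n} → m ℕ.< n → ⟦ m ⟧ < ⟦ n ⟧
  ⟦⟧-mono-< {m} {n} m<n rewrite ⟦⟧≡mkℚ m | ⟦⟧≡mkℚ n =
    *<* (subst₂ ℤ._<_ (sym (ℤ.*-identityʳ _)) (sym (ℤ.*-identityʳ _)) (ℤ.+<+ m<n))

  ⟦⟧-homo-* : ∀ m n → ⟦ m ℕ.* n ⟧ ≡ ⟦ m ⟧ * ⟦ n ⟧
  ⟦⟧-homo-* m n = trans (cong (_/ 1) (ℤ.pos-* m n)) (sym (cong₂ _*_ (⟦⟧≡mkℚ m) (⟦⟧≡mkℚ n)))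

  0≤⟦⟧ : ∀ m → 0ℚ ≤ ⟦ m ⟧
  0≤⟦⟧ m = ⟦⟧-mono-≤ {0} {m} ℕ.z≤n

  0≤⟦m⟧/⟦n⟧ : ∀ m n → 0ℚ ≤ ⟦ m ⟧ ÷' ⟦ n ⟧
  0≤⟦m⟧/⟦n⟧ m ℕ.zero    = ≤-refl
  0≤⟦m⟧/⟦n⟧ m (ℕ.suc n) = ÷'-nonNeg (0≤⟦⟧ m) (⟦⟧-mono-< {0} {ℕ.suc n} (ℕ.s≤s ℕ.z≤n))

  p≤∣p∣ : ∀ p → p ≤ ∣ p ∣
  p≤∣p∣ p with 0ℚ ≤? p
  ... | yes p≥0 = ≤-reflexive (sym (0≤p⇒∣p∣≡p p≥0))
  ... | no  p≱0 = ≤-trans (<⇒≤ (≰⇒> p≱0)) (0≤∣p∣ p)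

  q-p≤∣p-q∣ : ∀ p q → q - p ≤ ∣ p - q ∣
  q-p≤∣p-q∣ p q = begin
    q - p          ≡⟨ solve 2 (λ p q → q :- p := :- (p :- q)) refl p q ⟩
    - (p - q)      ≤⟨ p≤∣p∣ (- (p - q)) ⟩
    ∣ - (p - q) ∣  ≡⟨ ∣-p∣≡∣p∣ (p - q) ⟩
    ∣ p - q ∣      ∎
    where open ≤-Reasoning

  squeeze-⟶0 : ∀ {t R : ℕ.ℕ → ℚ} {L} κ → 0ℚ < κ →
               (∀ j → 0ℚ ≤ t j) → (∀ j → t j ≤ κ * (L - R j)) → R ⟶ L → t ⟶ 0ℚ
  squeeze-⟶0 {t} {R} {L} κ κ>0 t≥0 t≤κ[L-R] R⟶L ε ε>0
    with R⟶L (ε ÷' κ) (÷'-pos ε>0 κ>0)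
  ... | N , close = N , λ j N≤j → begin-strict
    ∣ t j - 0ℚ ∣     ≡⟨ trans (cong ∣_∣ (+-identityʳ (t j))) (0≤p⇒∣p∣≡p (t≥0 j)) ⟩
    t j              ≤⟨ t≤κ[L-R] j ⟩
    κ * (L - R j)    ≤⟨ *-monoˡ-≤-nonNeg κ (q-p≤∣p-q∣ (R j) L) ⟩
    κ * ∣ R j - L ∣  <⟨ *-monoʳ-<-pos κ (close j N≤j) ⟩
    κ * (ε ÷' κ)     ≡⟨ *-comm κ (ε ÷' κ) ⟩
    (ε ÷' κ) * κ     ≡⟨ ÷'-*-cancel ε κ>0 ⟩
    ε                ∎
    where
    open ≤-Reasoning
    instance
      _ = positive κ>0
      _ = nonNegative (<⇒≤ κ>0)

  [a/K]/[b/D]*K≤D : ∀ {a b K D} → a ≤ b → 0ℚ < b → 0ℚ < K → 0ℚ < D →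
                    ((a ÷' K) ÷' (b ÷' D)) * K ≤ D
  [a/K]/[b/D]*K≤D {a} {b} {K} {D} a≤b b>0 K>0 D>0 =
    *-cancelʳ-≤-pos b {{positive b>0}} (begin
    R * K * b          ≡⟨ cong (R * K *_) (÷'-*-cancel b D>0) ⟨
    R * K * (M * D)    ≡⟨ solve 4 (λ R K M D → R :* K :* (M :* D) := R :* M :* K :* D) refl R K M D ⟩
    R * M * K * D      ≡⟨ cong (λ x → x * K * D) (÷'-*-cancel (a ÷' K) (÷'-pos b>0 D>0)) ⟩
    (a ÷' K) * K * D   ≡⟨ cong (_* D) (÷'-*-cancel a K>0) ⟩
    a * D              ≤⟨ *-monoʳ-≤-nonNeg D {{nonNegative (<⇒≤ D>0)}} a≤b ⟩
    b * D              ≡⟨ *-comm b D ⟩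
    D * b              ∎)
    where
    open ≤-Reasoning
    M R : ℚ
    M = b ÷' D
    R = (a ÷' K) ÷' M

  ρ/K≤κ*[1-R] : ∀ κ {ρ K R D} → 0ℚ ≤ κ → 0ℚ < K →
                R * K ≤ D → κ * D + ρ ≤ κ * K → ρ ÷' K ≤ κ * (1ℚ - R)
  ρ/K≤κ*[1-R] κ {ρ} {K} {R} {D} κ≥0 K>0 RK≤D κD+ρ≤κK =
    *-cancelʳ-≤-pos K {{positive K>0}} (begin
    (ρ ÷' K) * K            ≡⟨ ÷'-*-cancel ρ K>0 ⟩
    ρ                       ≡⟨ solve 2 (λ x ρ → ρ := x :+ ρ :- x) refl (κ * D) ρ ⟩
    κ * D + ρ - κ * D       ≤⟨ +-monoˡ-≤ (- (κ * D)) κD+ρ≤κK ⟩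
    κ * K - κ * D           ≤⟨ +-monoʳ-≤ (κ * K) (neg-antimono-≤ κRK≤κD) ⟩
    κ * K - κ * (R * K)     ≡⟨ factor ⟩
    κ * (1ℚ - R) * K        ∎)
    where
    open ≤-Reasoning
    κRK≤κD : κ * (R * K) ≤ κ * D
    κRK≤κD = *-monoˡ-≤-nonNeg κ {{nonNegative κ≥0}} RK≤D
    factor : κ * K - κ * (R * K) ≡ κ * (1ℚ - R) * K
    factor = solve 3 (λ κ K R → κ :* K :- κ :* (R :* K) := κ :* (con 1ℚ :- R) :* K) refl κ K R

  4*[K-ρ+X]+ρ≤4*K : ∀ K ρ X → ⟦ 4 ⟧ * X ≤ ⟦ 3 ⟧ * ρ →
                    ⟦ 4 ⟧ * ((K - ρ) + X) + ρ ≤ ⟦ 4 ⟧ * K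
  4*[K-ρ+X]+ρ≤4*K K ρ X 4X≤3ρ = begin
    ⟦ 4 ⟧ * ((K - ρ) + X) + ρ        ≡⟨ cong (_+ ρ) (*-distribˡ-+ ⟦ 4 ⟧ (K - ρ) X) ⟩
    ⟦ 4 ⟧ * (K - ρ) + ⟦ 4 ⟧ * X + ρ  ≤⟨ +-monoˡ-≤ ρ (+-monoʳ-≤ (⟦ 4 ⟧ * (K - ρ)) 4X≤3ρ) ⟩
    ⟦ 4 ⟧ * (K - ρ) + ⟦ 3 ⟧ * ρ + ρ  ≡⟨ collect ⟩
    ⟦ 4 ⟧ * K                        ∎
    where
    open ≤-Reasoning
    collect : ⟦ 4 ⟧ * (K - ρ) + ⟦ 3 ⟧ * ρ + ρ ≡ ⟦ 4 ⟧ * K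
    collect = solve 2 (λ K ρ → con ⟦ 4 ⟧ :* (K :- ρ) :+ con ⟦ 3 ⟧ :* ρ :+ ρ := con ⟦ 4 ⟧ :* K) refl K ρ

  r/k≤4*[1-NLB/MMS] : ∀ n k .{{_ : ℕ.NonZero k}} → 3 ℕ.≤ k → 2 ℕ.* k ℕ.< n →
                      ⟦ rr n k ⟧ ÷' ⟦ k ⟧ ≤ ⟦ 4 ⟧ * (1ℚ - NLB n k ÷' MMS n k)
  r/k≤4*[1-NLB/MMS] n k 3≤k 2k<n =
    ρ/K≤κ*[1-R] ⟦ 4 ⟧ {ρ} {K} {NLB n k ÷' MMS n k} {D} (0≤⟦⟧ 4) K>0
      ([a/K]/[b/D]*K≤D a≤b b>0 K>0 D>0)
      (4*[K-ρ+X]+ρ≤4*K K ρ X 4X≤3ρ)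
    where
    c r : ℕ.ℕ
    c = cc n k
    r = rr n k
    K ρ Z X D : ℚ
    K = ⟦ k ⟧
    ρ = ⟦ r ⟧
    Z = ⟦ n ℕ.∸ c ⟧
    X = ⟦ r ℕ.* ℕ.suc c ⟧ ÷' Z
    D = (K - ρ) + X
    c<n : c ℕ.< n
    c<n = n/k<n n k 3≤k 2k<n
    K>0 : 0ℚ < K
    K>0 = ⟦⟧-mono-< (ℕ.≤-trans (ℕ.s≤s ℕ.z≤n) 3≤k)
    Z>0 : 0ℚ < Z
    Z>0 = ⟦⟧-mono-< (ℕ.m<n⇒0<n∸m c<n)
    b>0 : 0ℚ < ⟦ n C c ⟧
    b>0 = ⟦⟧-mono-< (k≤n⇒0<nCk (ℕ.<⇒≤ c<n))
    a≤b : ⟦ (n ℕ.∸ r) C c ⟧ ≤ ⟦ n C c ⟧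
    a≤b = ⟦⟧-mono-≤ (C-monoˡ-≤ c (ℕ.m∸n≤m n r))
    K-ρ>0 : 0ℚ < K - ρ
    K-ρ>0 = subst (_< K - ρ) (+-inverseʳ ρ) (+-monoˡ-< (- ρ) (⟦⟧-mono-< (m%n<n n k)))
    D>0 : 0ℚ < D
    D>0 = +-mono-<-≤ K-ρ>0 (÷'-nonNeg (0≤⟦⟧ (r ℕ.* ℕ.suc c)) Z>0)
    4X≤3ρ : ⟦ 4 ⟧ * X ≤ ⟦ 3 ⟧ * ρ
    4X≤3ρ = *-÷'-≤ ⟦ 4 ⟧ Z>0 (subst₂ _≤_
      (⟦⟧-homo-* 4 (r ℕ.* ℕ.suc c))
      (trans (⟦⟧-homo-* (3 ℕ.* r) (n ℕ.∸ c)) (cong (_* Z) (⟦⟧-homo-* 3 r)))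
      (⟦⟧-mono-≤ (4*[r*[1+n/k]]≤3*r*[n∸n/k] n k 3≤k 2k<n r)))

open import Data.Nat using (ℕ; _<_; _≤_; _*_; NonZero; s≤s; z≤n)
open import Data.Rational using (ℚ; 1ℚ; 0ℚ)
open import Relation.Nullary using (¬_)

lemma5 : (n k : ℕ → ℕ)
         → (hk : ∀ j → 3 ≤ k j)
         → (∀ j → 2 * k j < n j)
         → n ⟶∞
         → ¬ ((λ j → ⟦ rr (n j) (k j) {{≥3-nonZero (hk j)}} ⟧ ÷' ⟦ k j ⟧) ⟶ 0ℚ)
         → ¬ ((λ j → NLB (n j) (k j) {{≥3-nonZero (hk j)}} ÷' MMS (n j) (k j) {{≥3-nonZero (hk j)}}) ⟶ 1ℚ)
lemma5 n k hk 2k<n _ r/k↛0 NLB/MMS⟶1 =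
  r/k↛0 (squeeze-⟶0 {R = NLB/MMS} {L = 1ℚ} ⟦ 4 ⟧ (⟦⟧-mono-< {0} {4} (s≤s z≤n))
    (λ j → 0≤⟦m⟧/⟦n⟧ (rr (n j) (k j) {{k≢0 j}}) (k j))
    (λ j → r/k≤4*[1-NLB/MMS] (n j) (k j) {{k≢0 j}} (hk j) (2k<n j))
    NLB/MMS⟶1)
  where
  k≢0 : ∀ j → NonZero (k j)
  k≢0 j = ≥3-nonZero (hk j)
  NLB/MMS : ℕ → ℚ
  NLB/MMS j = NLB (n j) (k j) {{k≢0 j}} ÷' MMS (n j) (k j) {{k≢0 j}}
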